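{- For every sum indecomposable permutation $\pi$ of length $n$, either (1) $\pi$ is one of $n\cdots 21$, $12\cdots(n-1)\ominus 1$, or $1\ominus 12\cdots(n-1)$, or (2) $\pi$ contains two distinct sum indecomposable permutations of length $n-1$. In particular, if a permutation class contains two sum indecomposable permutations of length $n\ge 4$, then it also contains two sum indecomposable permutations of length $n-1$.
   Context: Containment is via order-isomorphic subsequences; a permutation class is a downset under containment. $\alpha\oplus\beta$ is $\alpha$ followed by $\beta$ shifted up by $|\alpha|$; $\alpha\ominus\beta$ is $\alpha$ shifted up by $|\beta|$ followed by $\beta$. A permutation is sum indecomposable if it is not $\alpha\oplus\beta$ with $\alpha,\beta$ nonempty. Permutations are written in one-line notation. -}

module Defs where

open import Data.Nat using (ℕ; zero; suc; _+_; _∸_; _<_; _≤_)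
open import Data.List using (List; []; _∷_; _++_; map; length; upTo; downFrom; zip)
open import Data.List.Membership.Propositional using (_∈_)
open import Data.List.Relation.Binary.Permutation.Propositional using (_↭_)
open import Data.List.Relation.Binary.Sublist.Propositional using (_⊆_)
open import Data.Product using (Σ; ∃; ∃-syntax; _×_; _,_)
open import Relation.Binary.PropositionalEquality using (_≡_; _≢_)
open import Relation.Nullary using (¬_)

-- Permutations in one-line notation, 0-based: a permutation of length n
-- is a list which is a rearrangement of [0, 1, …, n-1].
IsPerm : List ℕ → Set
IsPerm π = π ↭ upTo (length π)

incr : ℕ → List ℕ
incr k = upTo k

decr : ℕ → List ℕ
decr k = downFrom k

_⊕_ : List ℕ → List ℕ → List ℕ
α ⊕ β = α ++ map (λ x → x + length α) β

_⊖_ : List ℕ → List ℕ → List ℕ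
α ⊖ β = map (λ x → x + length β) α ++ β

OrderIso : List ℕ → List ℕ → Set
OrderIso s t = length s ≡ length t ×
  (∀ {x y x′ y′} → (x , y) ∈ zip s t → (x′ , y′) ∈ zip s t →
     (x < x′ → y < y′) × (y < y′ → x < x′))

_≼_ : List ℕ → List ℕ → Set
σ ≼ π = ∃[ s ] (s ⊆ π × OrderIso s σ)

SumIndecomposable : List ℕ → Set
SumIndecomposable π = IsPerm π ×
  ¬ (∃[ α ] ∃[ β ] (IsPerm α × IsPerm β × 1 ≤ length α × 1 ≤ length β × π ≡ α ⊕ β))

record PermClass : Set₁ where
  field
    mem      : List ℕ → Set
    mem-perm : ∀ {π} → mem π → IsPerm π
    downset  : ∀ {σ π} → mem π → IsPerm σ → σ ≼ π → mem σ
open PermClass public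

-- Delete an entry of π and relabel the remaining values to 0, …, n − 2: the result is
-- contained in π, and it is sum indecomposable exactly when the remaining entries admit no
-- cut, i.e. no split into a nonempty prefix lying entirely below a nonempty suffix.  Try the
-- four extreme entries: the maximum, the minimum, the first and the last.  Since π itself has
-- no cut, the maximum is not last and the minimum not first, deleting the first entry and
-- deleting the minimum cannot both leave a cut, and neither can deleting the last entry and
-- deleting the maximum.  So two of these deletions always succeed, and comparing the two
-- results at their first or last entry, or at the position of their maximum, shows that they
-- differ unless π is n⋯21, 23⋯n1 or n12⋯(n−1).  For a class, each of these three exceptional
-- permutations of length at least 4 has a successful deletion, and the three results are
-- pairwise distinct.

module Submission where

open import Defs

open import Data.Empty using (⊥; ⊥-elim)
open import Data.List
  using (List; []; _∷_; _++_; _∷ʳ_; map; length; upTo; downFrom; applyUpTo; filter; zip; initLast; _∷ʳ′_)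
open import Data.List.Extrema.Nat using (min; min≤⊤; min≤xs; argmin-sel)
open import Data.List.Membership.Propositional using (_∈_; _∉_; find; lose)
open import Data.List.Membership.Propositional.Properties
  using (∈-++⁻; ∈-++⁺ˡ; ∈-++⁺ʳ; ∈-∃++; ∈-upTo⁺; ∈-upTo⁻; ∈-downFrom⁻; ∈-map⁻; ∈-map⁺)
open import Data.List.Properties
  using (∷-injective; ∷ʳ-injective; ∷ʳ-injectiveˡ; ∷ʳ-injectiveʳ; ++-assoc; ++-identityʳ; ++-conicalʳ;
         map-++; map-cong; map-∘; map-id-local; map-upTo; length-map; length-++; length-upTo;
         filter-all; filter-none; filter-++; ≡-dec)
open import Data.List.Relation.Binary.Permutation.Propositional using (_↭_; ↭-sym; ↭⇒↭ₛ)
open import Data.List.Relation.Binary.Permutation.Propositional.Properties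
  using (drop-mid; map⁺; ∈-resp-↭; ↭-length; filter-↭)
open import Data.List.Relation.Binary.Sublist.Heterogeneous using (_∷_) renaming (_∷ʳ_ to _skip_)
open import Data.List.Relation.Binary.Sublist.Propositional using (_⊆_; ⊆-refl)
open import Data.List.Relation.Unary.All as All using (All; []; _∷_)
open import Data.List.Relation.Unary.AllPairs using (_∷_)
open import Data.List.Relation.Unary.Any using (here; there; any?)
open import Data.List.Relation.Unary.Unique.Propositional using (Unique)
open import Data.List.Relation.Unary.Unique.Propositional.Properties using (upTo⁺)
open import Data.Nat using (ℕ; zero; suc; _+_; _∸_; _<_; _≤_; z≤n; s≤s; s≤s⁻¹; pred; _<?_; _≤?_; _≟_; ≢-nonZero)
open import Data.Nat.Properties
open import Data.Product using (Σ; ∃; ∃₂; ∃-syntax; _×_; _,_; proj₁; proj₂; map₁)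
open import Data.Sum using (_⊎_; inj₁; inj₂)
open import Function using (_∘_; id)
open import Relation.Binary.Definitions using (tri<; tri≈; tri>)
open import Relation.Binary.PropositionalEquality
  using (_≡_; _≢_; refl; sym; trans; cong; cong₂; subst; subst₂; module ≡-Reasoning)
  renaming (setoid to ≡-setoid)
open import Data.List.Relation.Binary.Permutation.Setoid.Properties (≡-setoid ℕ) using (Unique-resp-↭)
open import Relation.Nullary using (¬_; Dec; yes; no)
open import Relation.Nullary.Decidable using (map′; _×-dec_; _⊎-dec_; ¬?)

module _ {X : Set} where

  ++∷≢[] : ∀ (xs : List X) y ys → xs ++ y ∷ ys ≢ []
  ++∷≢[] []      _ _ ()
  ++∷≢[] (_ ∷ _) _ _ ()

  ≢[]⇒1≤length : ∀ (xs : List X) → xs ≢ [] → 1 ≤ length xs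
  ≢[]⇒1≤length []      xs≢[] = ⊥-elim (xs≢[] refl)
  ≢[]⇒1≤length (_ ∷ _) _     = s≤s z≤n

  1≤length⇒≢[] : ∀ (xs : List X) → 1 ≤ length xs → xs ≢ []
  1≤length⇒≢[] (_ ∷ _) _ ()

  head∈prefix : ∀ (A : List X) {B h T} → A ++ B ≡ h ∷ T → A ≢ [] → h ∈ A
  head∈prefix []      _  A≢[] = ⊥-elim (A≢[] refl)
  head∈prefix (a ∷ A) eq _    with refl ← proj₁ (∷-injective eq) = here refl

  ∃-init-last : ∀ (xs : List X) → xs ≢ [] → ∃₂ λ I ℓ → xs ≡ I ∷ʳ ℓ
  ∃-init-last xs xs≢[] with initLast xs
  ... | []      = ⊥-elim (xs≢[] refl)
  ... | I ∷ʳ′ ℓ = I , ℓ , refl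

  map-fixed : ∀ (g : X → X) {xs x} → map g xs ≡ xs → x ∈ xs → g x ≡ x
  map-fixed g {_ ∷ _} eq (here refl) = proj₁ (∷-injective eq)
  map-fixed g {_ ∷ _} eq (there x∈)  = map-fixed g (proj₂ (∷-injective eq)) x∈

  levi : ∀ (P S A B : List X) → P ++ S ≡ A ++ B →
    (∃ λ C → P ≡ A ++ C × B ≡ C ++ S) ⊎ (∃ λ C → A ≡ P ++ C × S ≡ C ++ B)
  levi []      S A       B eq = inj₂ (A , refl , eq)
  levi (p ∷ P) S []      B eq = inj₁ (p ∷ P , refl , sym eq)
  levi (p ∷ P) S (a ∷ A) B eq with refl , eq′ ← ∷-injective eq with levi P S A B eq′
  ... | inj₁ (C , P≡ , B≡) = inj₁ (C , cong (p ∷_) P≡ , B≡)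
  ... | inj₂ (C , A≡ , S≡) = inj₂ (C , cong (p ∷_) A≡ , S≡)

  last∈suffix : ∀ (A B Y : List X) z → A ++ B ≡ Y ∷ʳ z → B ≢ [] → z ∈ B
  last∈suffix A B Y z eq B≢[] with levi Y (z ∷ []) A B (sym eq)
  ... | inj₁ (C , _ , refl)    = ∈-++⁺ʳ C (here refl)
  ... | inj₂ ([] , _ , refl)   = here refl
  ... | inj₂ (_ ∷ C , _ , eq′) = ⊥-elim (B≢[] (++-conicalʳ C B (sym (proj₂ (∷-injective eq′)))))

  suffix-∷ʳ : ∀ (P : List X) v S Y z → P ++ v ∷ S ≡ Y ∷ʳ z → S ≢ [] → ∃ λ S′ → S ≡ S′ ∷ʳ z
  suffix-∷ʳ P v S Y z eq S≢[] with levi P (v ∷ S) Y (z ∷ []) eq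
  ... | inj₁ ([] , _ , e)    = ⊥-elim (S≢[] (sym (proj₂ (∷-injective e))))
  ... | inj₁ (_ ∷ C , _ , e) = ⊥-elim (++∷≢[] C v S (sym (proj₂ (∷-injective e))))
  ... | inj₂ ([] , _ , e)    = ⊥-elim (S≢[] (proj₂ (∷-injective e)))
  ... | inj₂ (_ ∷ C , _ , e) = C , proj₂ (∷-injective e)

  viewHead : ∀ {π : List X} {f T} P v S → π ≡ f ∷ T → π ≡ P ++ v ∷ S →
    (P ≡ [] × v ≡ f × S ≡ T) ⊎ (∃ λ Q → P ≡ f ∷ Q × T ≡ Q ++ v ∷ S)
  viewHead [] v S refl eq with refl , refl ← ∷-injective eq = inj₁ (refl , refl , refl)
  viewHead (x ∷ Q) v S refl eq with refl , refl ← ∷-injective eq = inj₂ (Q , refl , refl)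

  viewLast : ∀ {π : List X} {I ℓ} P v S → π ≡ I ∷ʳ ℓ → π ≡ P ++ v ∷ S →
    (S ≡ [] × P ≡ I × v ≡ ℓ) ⊎ (∃ λ S′ → S ≡ S′ ∷ʳ ℓ × I ≡ P ++ v ∷ S′)
  viewLast {I = I} {ℓ} P v [] refl eq with refl , refl ← ∷ʳ-injective P I (sym eq) = inj₁ (refl , refl , refl)
  viewLast {I = I} {ℓ} P v (s ∷ S) refl eq with suffix-∷ʳ P v (s ∷ S) I ℓ (sym eq) (λ ())
  ... | S′ , S≡ = inj₂ (S′ , S≡ , ∷ʳ-injectiveˡ I (P ++ v ∷ S′) (begin
    I ∷ʳ ℓ                 ≡⟨ eq ⟩
    P ++ v ∷ s ∷ S         ≡⟨ cong (λ t → P ++ v ∷ t) S≡ ⟩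
    P ++ v ∷ (S′ ∷ʳ ℓ)     ≡⟨ ++-assoc P (v ∷ S′) (ℓ ∷ []) ⟨
    (P ++ v ∷ S′) ∷ʳ ℓ     ∎))
    where open ≡-Reasoning

  position-unique : ∀ (A B A′ B′ : List X) x → A ++ x ∷ B ≡ A′ ++ x ∷ B′ → x ∉ A → x ∉ A′ →
    length A ≡ length A′
  position-unique []      B []       B′ x eq x∉A x∉A′ = refl
  position-unique []      B (a ∷ A′) B′ x eq x∉A x∉A′ with refl , _ ← ∷-injective eq =
    ⊥-elim (x∉A′ (here refl))
  position-unique (a ∷ A) B []       B′ x eq x∉A x∉A′ with refl , _ ← ∷-injective eq =
    ⊥-elim (x∉A (here refl))
  position-unique (a ∷ A) B (_ ∷ A′) B′ x eq x∉A x∉A′ with refl , eq′ ← ∷-injective eq =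
    cong suc (position-unique A B A′ B′ x eq′ (x∉A ∘ there) (x∉A′ ∘ there))

  unique-disjoint : ∀ {xs : List X} → Unique xs → ∀ A B {x} → xs ≡ A ++ B → x ∈ A → x ∉ B
  unique-disjoint (x∉ ∷ _) (a ∷ A) B refl (here refl) x∈B = All.lookup x∉ (∈-++⁺ʳ A x∈B) refl
  unique-disjoint (_  ∷ u) (a ∷ A) B refl (there x∈A) x∈B = unique-disjoint u A B refl x∈A x∈B

  unique-∉-around : ∀ {xs : List X} → Unique xs → ∀ P v S → xs ≡ P ++ v ∷ S → v ∉ P × v ∉ S
  unique-∉-around u P v S eq =
    (λ v∈P → unique-disjoint u P (v ∷ S) eq v∈P (here refl)) ,
    (λ v∈S → unique-disjoint u (P ∷ʳ v) S (trans eq (sym (++-assoc P (v ∷ []) S))) (∈-++⁺ʳ P (here refl)) v∈S)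

  ∈-after : ∀ {xs : List X} → Unique xs → ∀ P v S A B {x} → xs ≡ P ++ v ∷ S → xs ≡ A ++ B →
    v ∈ A → x ∈ B → x ∈ S
  ∈-after u P v S A B eq eq′ v∈A x∈B with levi P (v ∷ S) A B (trans (sym eq) eq′)
  ... | inj₁ (C , _ , B≡)      =
    ⊥-elim (unique-disjoint u A B eq′ v∈A (subst (v ∈_) (sym B≡) (∈-++⁺ʳ C (here refl))))
  ... | inj₂ ([] , _ , vS≡)    = ⊥-elim (unique-disjoint u A B eq′ v∈A (subst (v ∈_) vS≡ (here refl)))
  ... | inj₂ (_ ∷ C , _ , vS≡) = subst (_ ∈_) (sym (proj₂ (∷-injective vS≡))) (∈-++⁺ʳ C x∈B)

  ∈-before : ∀ {xs : List X} → Unique xs → ∀ P v S A B {x} → xs ≡ P ++ v ∷ S → xs ≡ A ++ B →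
    x ∈ A → v ∈ B → x ∈ P
  ∈-before u P v S A B eq eq′ x∈A v∈B with levi P (v ∷ S) A B (trans (sym eq) eq′)
  ... | inj₁ (C , P≡ , _)       = subst (_ ∈_) (sym P≡) (∈-++⁺ˡ x∈A)
  ... | inj₂ ([] , A≡ , _)      = subst (_ ∈_) (trans A≡ (++-identityʳ P)) x∈A
  ... | inj₂ (_ ∷ C , A≡ , vS≡) with refl ← proj₁ (∷-injective vS≡) =
    ⊥-elim (unique-disjoint u A B eq′ (subst (_ ∈_) (sym A≡) (∈-++⁺ʳ P (here refl))) v∈B)

-- Relabelling after a deletion

-- The junk value squeeze v v ≡ v is why injectivity and strict monotonicity need x ≢ v.
squeeze : ℕ → ℕ → ℕ
squeeze zero    zero    = zero
squeeze zero    (suc x) = x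
squeeze (suc v) zero    = zero
squeeze (suc v) (suc x) = suc (squeeze v x)

squeeze-≤ : ∀ {v x} → x ≤ v → squeeze v x ≡ x
squeeze-≤ {zero}  {zero}  _       = refl
squeeze-≤ {suc v} {zero}  _       = refl
squeeze-≤ {suc v} {suc x} (s≤s p) = cong suc (squeeze-≤ p)

squeeze-> : ∀ {v x} → v ≤ x → squeeze v (suc x) ≡ x
squeeze-> {zero}  {x}     _       = refl
squeeze-> {suc v} {suc x} (s≤s p) = cong suc (squeeze-> p)

squeeze-zero : ∀ x → squeeze 0 x ≡ pred x
squeeze-zero zero    = refl
squeeze-zero (suc x) = refl

squeeze-mono-≤ : ∀ v {x y} → x ≤ y → squeeze v x ≤ squeeze v y
squeeze-mono-≤ zero    {zero}  {y}     _       = z≤n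
squeeze-mono-≤ zero    {suc x} {suc y} (s≤s p) = p
squeeze-mono-≤ (suc v) {zero}  {y}     _       = z≤n
squeeze-mono-≤ (suc v) {suc x} {suc y} (s≤s p) = s≤s (squeeze-mono-≤ v p)

squeeze-cancel-< : ∀ v {x y} → squeeze v x < squeeze v y → x < y
squeeze-cancel-< v {x} {y} p with x <? y
... | yes x<y = x<y
... | no  x≮y = ⊥-elim (<⇒≱ p (squeeze-mono-≤ v (≮⇒≥ x≮y)))

squeeze-mono-< : ∀ v {x y} → x < y → x ≢ v → y ≢ v → squeeze v x < squeeze v y
squeeze-mono-< zero    {zero}  {suc y}       _       x≢v _   = ⊥-elim (x≢v refl)
squeeze-mono-< zero    {suc x} {suc y}       (s≤s p) _   _   = p
squeeze-mono-< (suc v) {zero}  {suc zero}    _       _   _   = s≤s z≤n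
squeeze-mono-< (suc v) {zero}  {suc (suc y)} _       _   _   = s≤s z≤n
squeeze-mono-< (suc v) {suc x} {suc y}       (s≤s p) x≢v y≢v =
  s≤s (squeeze-mono-< v p (x≢v ∘ cong suc) (y≢v ∘ cong suc))

squeeze-injective : ∀ v {x y} → squeeze v x ≡ squeeze v y → x ≢ v → y ≢ v → x ≡ y
squeeze-injective v {x} {y} eq x≢v y≢v with <-cmp x y
... | tri< x<y _ _ = ⊥-elim (<-irrefl eq (squeeze-mono-< v x<y x≢v y≢v))
... | tri≈ _ x≡y _ = x≡y
... | tri> _ _ y<x = ⊥-elim (<-irrefl (sym eq) (squeeze-mono-< v y<x y≢v x≢v))

squeeze-fixed⇒≤ : ∀ {v x} → squeeze v x ≡ x → x ≤ v
squeeze-fixed⇒≤ {v} {x} eq with x ≤? v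
... | yes x≤v = x≤v
... | no  x≰v with x | ≰⇒> x≰v
...   | suc y | s≤s v≤y = ⊥-elim (1+n≢n (sym (trans (sym (squeeze-> v≤y)) eq)))

squeeze≡⇒≡suc : ∀ {v a x} → v ≤ a → x ≢ v → squeeze v x ≡ a → x ≡ suc a
squeeze≡⇒≡suc {v} {a} {x} v≤a x≢v eq with x ≤? v
... | yes x≤v = ⊥-elim (x≢v (≤-antisym x≤v (subst (v ≤_) (trans (sym eq) (squeeze-≤ x≤v)) v≤a)))
... | no  x≰v with x | ≰⇒> x≰v
...   | suc y | s≤s v≤y = cong suc (trans (sym (squeeze-> v≤y)) eq)

squeeze-<-≤-distinct : ∀ {u x w} → u < x → x ≤ w → squeeze u x ≢ squeeze w x
squeeze-<-≤-distinct {u} {suc x} (s≤s u≤x) x<w eq =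
  1+n≢n (sym (trans (sym (squeeze-> u≤x)) (trans eq (squeeze-≤ x<w))))

interval : ℕ → ℕ → List ℕ
interval a zero    = []
interval a (suc k) = a ∷ interval (suc a) k

interval-++ : ∀ a b c → interval a (b + c) ≡ interval a b ++ interval (a + b) c
interval-++ a zero    c = cong (λ t → interval t c) (sym (+-identityʳ a))
interval-++ a (suc b) c = cong (a ∷_) (trans (interval-++ (suc a) b c)
  (cong (λ t → interval (suc a) b ++ interval t c) (sym (+-suc a b))))

length-interval : ∀ a k → length (interval a k) ≡ k
length-interval a zero    = refl
length-interval a (suc k) = cong suc (length-interval (suc a) k)

∈-interval⁻ : ∀ {a k x} → x ∈ interval a k → a ≤ x × x < a + k
∈-interval⁻ {a} {suc k}     (here refl) = ≤-refl , m<m+n a (s≤s z≤n)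
∈-interval⁻ {a} {suc k} {x} (there p) with a<x , x<a+k ← ∈-interval⁻ p =
  <⇒≤ a<x , subst (x <_) (sym (+-suc a k)) x<a+k

map-+-interval : ∀ c a k → map (_+ c) (interval a k) ≡ interval (a + c) k
map-+-interval c a zero    = refl
map-+-interval c a (suc k) = cong (a + c ∷_) (map-+-interval c (suc a) k)

map-∸-interval : ∀ c a k → map (_∸ c) (interval (c + a) k) ≡ interval a k
map-∸-interval c a zero    = refl
map-∸-interval c a (suc k) = cong₂ _∷_ (m+n∸m≡n c a)
  (trans (cong (λ t → map (_∸ c) (interval t k)) (sym (+-suc c a))) (map-∸-interval c (suc a) k))

upTo≡interval : ∀ k → upTo k ≡ interval 0 k
upTo≡interval zero    = refl
upTo≡interval (suc k) = cong (0 ∷_) (begin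
  applyUpTo suc k               ≡⟨ map-upTo suc k ⟨
  map suc (upTo k)              ≡⟨ cong (map suc) (upTo≡interval k) ⟩
  map suc (interval 0 k)        ≡⟨ map-cong (λ x → +-comm 1 x) (interval 0 k) ⟩
  map (_+ 1) (interval 0 k)     ≡⟨ map-+-interval 1 0 k ⟩
  interval 1 k                  ∎)
  where open ≡-Reasoning

map-squeeze-below : ∀ v a k → a + k ≤ v → map (squeeze v) (interval a k) ≡ interval a k
map-squeeze-below v a zero    _ = refl
map-squeeze-below v a (suc k) p = cong₂ _∷_ (squeeze-≤ (≤-trans (m≤m+n a (suc k)) p))
  (map-squeeze-below v (suc a) k (subst (_≤ v) (+-suc a k) p))

map-squeeze-above : ∀ v b k → v ≤ b → map (squeeze v) (interval (suc b) k) ≡ interval b k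
map-squeeze-above v b zero    _ = refl
map-squeeze-above v b (suc k) p = cong₂ _∷_ (squeeze-> p) (map-squeeze-above v (suc b) k (m≤n⇒m≤1+n p))

-- Equality of two reducts of an exceptional permutation unfolds to one of the following three
-- shift equations, each of which forces a run of consecutive values.
shift-down⇒downFrom : ∀ k (xs : List ℕ) → 0 ∉ xs → xs ∷ʳ 0 ≡ k ∷ map pred xs →
  xs ∷ʳ 0 ≡ downFrom (suc k)
shift-down⇒downFrom k []           _  eq with refl , _ ← ∷-injective eq = refl
shift-down⇒downFrom k (zero ∷ xs)  0∉ _  = ⊥-elim (0∉ (here refl))
shift-down⇒downFrom k (suc y ∷ xs) 0∉ eq with refl , eq′ ← ∷-injective eq =
  cong (suc y ∷_) (shift-down⇒downFrom y xs (0∉ ∘ there) eq′)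

squeeze-shift⇒interval : ∀ v a Q x R → v ≤ a → x ≢ v → (∀ {y} → y ∈ Q → y ≢ v) →
  map (squeeze v) (Q ++ x ∷ R) ≡ a ∷ Q ++ R →
  Q ∷ʳ x ≡ interval (suc a) (suc (length Q)) × map (squeeze v) R ≡ R
squeeze-shift⇒interval v a []      x R v≤a x≢v _   eq with eq₁ , eq₂ ← ∷-injective eq =
  cong (_∷ []) (squeeze≡⇒≡suc v≤a x≢v eq₁) , eq₂
squeeze-shift⇒interval v a (y ∷ Q) x R v≤a x≢v Q≢v eq with eq₁ , eq₂ ← ∷-injective eq
  with refl ← squeeze≡⇒≡suc v≤a (Q≢v (here refl)) eq₁ =
  map₁ (cong (suc a ∷_))
    (squeeze-shift⇒interval v (suc a) Q x R (m≤n⇒m≤1+n v≤a) x≢v (Q≢v ∘ there) eq₂)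

pred-shift⇒interval : ∀ ℓ a (xs : List ℕ) → a < ℓ →
  (∀ {y} → y ∈ xs → y ≢ 0) → (∀ {y} → y ∈ xs → y ≢ ℓ) →
  a ∷ map (squeeze ℓ) xs ≡ map pred (xs ∷ʳ ℓ) → xs ∷ʳ ℓ ≡ interval (suc a) (suc (length xs))
pred-shift⇒interval (suc ℓ) a []           _   _   _   eq with refl , _ ← ∷-injective eq = refl
pred-shift⇒interval ℓ       a (zero ∷ xs)  _   ≢0  _   _  = ⊥-elim (≢0 (here refl) refl)
pred-shift⇒interval ℓ       a (suc y ∷ xs) a<ℓ ≢0 ≢ℓ eq with refl , eq′ ← ∷-injective eq =
  cong (suc a ∷_) (pred-shift⇒interval ℓ (suc a) xs a+1<ℓ (≢0 ∘ there) (≢ℓ ∘ there)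
    (trans (cong (_∷ map (squeeze ℓ) xs) (sym (squeeze-≤ (<⇒≤ a+1<ℓ)))) eq′))
  where
  a+1<ℓ : suc a < ℓ
  a+1<ℓ = ≤∧≢⇒< a<ℓ (≢ℓ (here refl))

incr⊖1 : ∀ K → incr K ⊖ (0 ∷ []) ≡ interval 1 K ∷ʳ 0
incr⊖1 K = cong (_∷ʳ 0) (trans (cong (map (_+ 1)) (upTo≡interval K)) (map-+-interval 1 0 K))

1⊖incr : ∀ K → (0 ∷ []) ⊖ incr K ≡ K ∷ interval 0 K
1⊖incr K = cong₂ _∷_ (length-upTo K) (upTo≡interval K)

module Permutation {π : List ℕ} (p : IsPerm π) where

  unique : Unique π
  unique = Unique-resp-↭ (↭⇒↭ₛ (↭-sym p)) (upTo⁺ (length π))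

  <length : ∀ {x} → x ∈ π → x < length π
  <length x∈π = ∈-upTo⁻ (∈-resp-↭ p x∈π)

  ∈-of-<length : ∀ {x} → x < length π → x ∈ π
  ∈-of-<length x< = ∈-resp-↭ (↭-sym p) (∈-upTo⁺ x<)

  ≤max : ∀ {M} → suc M ≡ length π → ∀ {x} → x ∈ π → x ≤ M
  ≤max {M} M+1≡n {x} x∈π = s≤s⁻¹ (subst (x <_) (sym M+1≡n) (<length x∈π))

filter-<-split : ∀ c {A B} → All (_< c) A → All (c ≤_) B → filter (_<? c) (A ++ B) ≡ A
filter-<-split c {A} {B} A<c c≤B = begin
  filter (_<? c) (A ++ B)                    ≡⟨ filter-++ (_<? c) A B ⟩
  filter (_<? c) A ++ filter (_<? c) B
    ≡⟨ cong₂ _++_ (filter-all (_<? c) A<c) (filter-none (_<? c) (All.map ≤⇒≯ c≤B)) ⟩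
  A ++ []                                    ≡⟨ ++-identityʳ A ⟩
  A                                          ∎
  where open ≡-Reasoning

filter-≥-split : ∀ c {A B} → All (_< c) A → All (c ≤_) B → filter (c ≤?_) (A ++ B) ≡ B
filter-≥-split c {A} {B} A<c c≤B = begin
  filter (c ≤?_) (A ++ B)                    ≡⟨ filter-++ (c ≤?_) A B ⟩
  filter (c ≤?_) A ++ filter (c ≤?_) B
    ≡⟨ cong₂ _++_ (filter-none (c ≤?_) (All.map <⇒≱ A<c)) (filter-all (c ≤?_) c≤B) ⟩
  B                                          ∎
  where open ≡-Reasoning

↭-split-at : ∀ c {A B A′ B′} → A ++ B ↭ A′ ++ B′ →
  All (_< c) A → All (c ≤_) B → All (_< c) A′ → All (c ≤_) B′ → A ↭ A′ × B ↭ B′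
↭-split-at c p A<c c≤B A′<c c≤B′ =
  subst₂ _↭_ (filter-<-split c A<c c≤B) (filter-<-split c A′<c c≤B′) (filter-↭ (_<? c) p) ,
  subst₂ _↭_ (filter-≥-split c A<c c≤B) (filter-≥-split c A′<c c≤B′) (filter-↭ (c ≤?_) p)

upTo-split : ∀ {c n} → c ≤ n → upTo n ≡ interval 0 c ++ interval c (n ∸ c)
upTo-split {c} {n} c≤n = begin
  upTo n                                ≡⟨ upTo≡interval n ⟩
  interval 0 n                          ≡⟨ cong (interval 0) (m+[n∸m]≡n c≤n) ⟨
  interval 0 (c + (n ∸ c))              ≡⟨ interval-++ 0 c (n ∸ c) ⟩
  interval 0 c ++ interval c (n ∸ c)    ∎
  where open ≡-Reasoning

↭-interval⇒isPerm : ∀ {xs k} → xs ↭ interval 0 k → IsPerm xs × length xs ≡ k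
↭-interval⇒isPerm {xs} {k} p = subst (λ m → xs ↭ upTo m) (sym len) (subst (xs ↭_) (sym (upTo≡interval k)) p) , len
  where
  len : length xs ≡ k
  len = trans (↭-length p) (length-interval 0 k)

-- Cuts and sum decompositions

infix 4 _≺_ _≺?_

_≺_ : List ℕ → List ℕ → Set
A ≺ B = ∀ {a b} → a ∈ A → b ∈ B → a < b

_≺?_ : ∀ A B → Dec (A ≺ B)
A ≺? B = map′ (λ q a∈A b∈B → All.lookup (All.lookup q a∈A) b∈B)
              (λ A≺B → All.tabulate (λ a∈A → All.tabulate (A≺B a∈A)))
              (All.all? (λ a → All.all? (a <?_) B) A)

record Cut (xs : List ℕ) : Set where
  constructor cut
  field
    lower upper : List ℕ
    split       : xs ≡ lower ++ upper
    lower≢[]    : lower ≢ []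
    upper≢[]    : upper ≢ []
    lower≺upper : lower ≺ upper

CutWithin : List ℕ → List ℕ → Set
CutWithin A B = ∃₂ λ C D → B ≡ C ++ D × A ++ C ≢ [] × D ≢ [] × A ++ C ≺ D

cutWithin? : ∀ A B → Dec (CutWithin A B)
cutWithin? A []      = no λ (C , D , eq , _ , D≢[] , _) → D≢[] (++-conicalʳ C D (sym eq))
cutWithin? A (b ∷ B) =
  map′ from to ((¬? (≡-dec _≟_ A []) ×-dec A ≺? b ∷ B) ⊎-dec cutWithin? (A ∷ʳ b) B)
  where
  assoc : ∀ C → (A ∷ʳ b) ++ C ≡ A ++ b ∷ C
  assoc C = ++-assoc A (b ∷ []) C
  to : CutWithin A (b ∷ B) → (A ≢ [] × A ≺ b ∷ B) ⊎ CutWithin (A ∷ʳ b) B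
  to ([] , D , refl , A≢[] , _ , A≺D) =
    inj₁ (A≢[] ∘ trans (++-identityʳ A) , A≺D ∘ subst (_ ∈_) (sym (++-identityʳ A)))
  to (c ∷ C , D , eq , _ , D≢[] , ≺D) with refl , B≡ ← ∷-injective eq =
    inj₂ (C , D , B≡ , ++∷≢[] A b C ∘ trans (sym (assoc C)) , D≢[] , ≺D ∘ subst (_ ∈_) (assoc C))
  from : (A ≢ [] × A ≺ b ∷ B) ⊎ CutWithin (A ∷ʳ b) B → CutWithin A (b ∷ B)
  from (inj₁ (A≢[] , A≺)) =
    [] , b ∷ B , refl , A≢[] ∘ trans (sym (++-identityʳ A)) , (λ ()) , A≺ ∘ subst (_ ∈_) (++-identityʳ A)
  from (inj₂ (C , D , refl , _ , D≢[] , ≺D)) =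
    b ∷ C , D , refl , ++∷≢[] A b C , D≢[] , ≺D ∘ subst (_ ∈_) (sym (assoc C))

cut? : ∀ xs → Dec (Cut xs)
cut? xs = map′ (λ (C , D , eq , C≢[] , D≢[] , C≺D) → cut C D eq C≢[] D≢[] C≺D)
               (λ (cut C D eq C≢[] D≢[] C≺D) → C , D , eq , C≢[] , D≢[] , λ {_} {_} → C≺D)
               (cutWithin? [] xs)

least : ∀ (B : List ℕ) → B ≢ [] → ∃ λ c → c ∈ B × All (c ≤_) B
least []      B≢[] = ⊥-elim (B≢[] refl)
least (b ∷ B) _    = min b B , min∈ , min≤⊤ b B ∷ min≤xs b B
  where
  min∈ : min b B ∈ b ∷ B
  min∈ with argmin-sel id b B
  ... | inj₁ min≡b = here min≡b
  ... | inj₂ min∈B = there min∈B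

cut⇒⊕ : ∀ {π} → IsPerm π → Cut π →
  ∃₂ λ α β → IsPerm α × IsPerm β × 1 ≤ length α × 1 ≤ length β × π ≡ α ⊕ β
cut⇒⊕ {π} p (cut A B refl A≢[] B≢[] A≺B) =
  A , β , perm-A , perm-β , ≢[]⇒1≤length A A≢[] , 1≤length-β , cong (A ++_) B≡
  where
  c = proj₁ (least B B≢[])
  c∈B = proj₁ (proj₂ (least B B≢[]))
  c≤B = proj₂ (proj₂ (least B B≢[]))
  k = length π ∸ c
  A<c : All (_< c) A
  A<c = All.tabulate (λ a∈A → A≺B a∈A c∈B)
  c≤n : c ≤ length π
  c≤n = <⇒≤ (Permutation.<length p (∈-++⁺ʳ A c∈B))
  sides : A ↭ interval 0 c × B ↭ interval c k
  sides = ↭-split-at c (subst (A ++ B ↭_) (upTo-split c≤n) p) A<c c≤B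
    (All.tabulate (proj₂ ∘ ∈-interval⁻)) (All.tabulate (proj₁ ∘ ∈-interval⁻))
  perm-A = proj₁ (↭-interval⇒isPerm (proj₁ sides))
  |A|≡c = proj₂ (↭-interval⇒isPerm (proj₁ sides))
  β = map (_∸ c) B
  perm-β : IsPerm β
  perm-β = proj₁ (↭-interval⇒isPerm (subst (β ↭_) (map-∸-interval c 0 k)
    (subst (λ t → β ↭ map (_∸ c) (interval t k)) (sym (+-identityʳ c)) (map⁺ (_∸ c) (proj₂ sides)))))
  1≤length-β : 1 ≤ length β
  1≤length-β = subst (1 ≤_) (sym (length-map (_∸ c) B)) (≢[]⇒1≤length B B≢[])
  B≡ : B ≡ map (_+ length A) β
  B≡ = sym (begin
    map (_+ length A) (map (_∸ c) B)   ≡⟨ map-∘ B ⟨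
    map (λ x → x ∸ c + length A) B
      ≡⟨ map-id-local (All.map (λ c≤x → trans (cong (_ ∸ c +_) |A|≡c) (m∸n+n≡m c≤x)) c≤B) ⟩
    B                                  ∎)
    where open ≡-Reasoning

⊕⇒cut : ∀ {α β} → IsPerm α → 1 ≤ length α → 1 ≤ length β → Cut (α ⊕ β)
⊕⇒cut {α} {β} pα 1≤|α| 1≤|β| =
  cut α (map (_+ length α) β) refl (1≤length⇒≢[] α 1≤|α|) β′≢[] α≺β′
  where
  β′≢[] : map (_+ length α) β ≢ []
  β′≢[] = 1≤length⇒≢[] _ (subst (1 ≤_) (sym (length-map _ β)) 1≤|β|)
  α≺β′ : α ≺ map (_+ length α) β
  α≺β′ a∈α b∈β′ with y , _ , refl ← ∈-map⁻ (_+ length α) b∈β′ =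
    <-≤-trans (Permutation.<length pα a∈α) (m≤n+m (length α) y)

sumIndecomposable⇒¬cut : ∀ {π} → SumIndecomposable π → ¬ Cut π
sumIndecomposable⇒¬cut (p , indec) c = indec (cut⇒⊕ p c)

¬cut⇒sumIndecomposable : ∀ {π} → IsPerm π → ¬ Cut π → SumIndecomposable π
¬cut⇒sumIndecomposable p ¬cut =
  p , λ (α , β , pα , _ , 1≤|α| , 1≤|β| , π≡) → ¬cut (subst Cut (sym π≡) (⊕⇒cut pα 1≤|α| 1≤|β|))

map-≡-++ : ∀ (g : ℕ → ℕ) xs A B → map g xs ≡ A ++ B →
  ∃₂ λ A₀ B₀ → xs ≡ A₀ ++ B₀ × map g A₀ ≡ A × map g B₀ ≡ B
map-≡-++ g xs       []      B eq = [] , xs , refl , refl , eq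
map-≡-++ g []       (_ ∷ _) B ()
map-≡-++ g (x ∷ xs) (a ∷ A) B eq with refl , eq′ ← ∷-injective eq with map-≡-++ g xs A B eq′
... | A₀ , B₀ , refl , refl , refl = x ∷ A₀ , B₀ , refl , refl , refl

cut-map⁻ : ∀ (g : ℕ → ℕ) → (∀ {x y} → g x < g y → x < y) → ∀ xs → Cut (map g xs) → Cut xs
cut-map⁻ g cancel xs (cut A B eq A≢[] B≢[] A≺B) with map-≡-++ g xs A B eq
... | A₀ , B₀ , xs≡ , refl , refl =
  cut A₀ B₀ xs≡ (A≢[] ∘ cong (map g)) (B≢[] ∘ cong (map g))
    (λ a∈ b∈ → cancel (A≺B (∈-map⁺ g a∈) (∈-map⁺ g b∈)))

0∉upper : ∀ {A B} → A ≢ [] → A ≺ B → 0 ∉ B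
0∉upper {[]}    A≢[] _   _   = A≢[] refl
0∉upper {_ ∷ _} _    A≺B 0∈B = n≮0 (A≺B (here refl) 0∈B)

≺-witness : ∀ {A B} → B ≢ [] → A ≺ B → ∀ {a} → a ∈ A → ∃ λ b → b ∈ B × a < b
≺-witness {B = []}    B≢[] _   _   = ⊥-elim (B≢[] refl)
≺-witness {B = b ∷ _} _    A≺B a∈A = b , here refl , A≺B a∈A (here refl)

¬cut-max-first : ∀ h X → (∀ {x} → x ∈ X → x ≤ h) → ¬ Cut (h ∷ X)
¬cut-max-first h X ≤h (cut []      _       _  A≢[] _    _)   = A≢[] refl
¬cut-max-first h X ≤h (cut (_ ∷ _) []      _  _    B≢[] _)   = B≢[] refl
¬cut-max-first h X ≤h (cut (_ ∷ A) (b ∷ B) eq _    _    A≺B) with refl , X≡ ← ∷-injective eq =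
  <⇒≱ (A≺B (here refl) (here refl)) (≤h (subst (b ∈_) (sym X≡) (∈-++⁺ʳ A (here refl))))

¬cut-min-last : ∀ Y z → (∀ {x} → x ∈ Y ∷ʳ z → z ≤ x) → ¬ Cut (Y ∷ʳ z)
¬cut-min-last Y z z≤ (cut []      _ _  A≢[] _    _)   = A≢[] refl
¬cut-min-last Y z z≤ (cut (a ∷ A) B eq _    B≢[] A≺B) =
  <⇒≱ (A≺B (here refl) (last∈suffix (a ∷ A) B Y z (sym eq) B≢[])) (z≤ (subst (a ∈_) (sym eq) (here refl)))

cut⇒head<last : ∀ h X Y z → h ∷ X ≡ Y ∷ʳ z → Cut (h ∷ X) → h < z
cut⇒head<last h X Y z eq (cut []      _ _   A≢[] _    _)   = ⊥-elim (A≢[] refl)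
cut⇒head<last h X Y z eq (cut (_ ∷ A) B eq′ _    B≢[] A≺B) with refl , _ ← ∷-injective eq′ =
  A≺B (here refl) (last∈suffix (h ∷ A) B Y z (trans (sym eq′) eq) B≢[])

record Deletion (π : List ℕ) : Set where
  constructor deletion
  field
    before : List ℕ
    entry  : ℕ
    after  : List ℕ
    split  : π ≡ before ++ entry ∷ after

remainder : ∀ {π} → Deletion π → List ℕ
remainder d = Deletion.before d ++ Deletion.after d

reduct : ∀ {π} → Deletion π → List ℕ
reduct d = map (squeeze (Deletion.entry d)) (remainder d)

module _ {π : List ℕ} (d d′ : Deletion π) where
  open Deletion

  reducts-differ-at-head : ∀ {x Y Y′} → remainder d ≡ x ∷ Y → remainder d′ ≡ x ∷ Y′ →
    squeeze (entry d) x ≢ squeeze (entry d′) x → reduct d ≢ reduct d′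
  reducts-differ-at-head {x} {Y} {Y′} eq eq′ x≢ d≡d′ = x≢ (proj₁ (∷-injective (begin
    squeeze (entry d) x ∷ map (squeeze (entry d)) Y       ≡⟨ cong (map (squeeze (entry d))) eq ⟨
    reduct d                                              ≡⟨ d≡d′ ⟩
    reduct d′                                             ≡⟨ cong (map (squeeze (entry d′))) eq′ ⟩
    squeeze (entry d′) x ∷ map (squeeze (entry d′)) Y′    ∎)))
    where open ≡-Reasoning

  reducts-differ-at-last : ∀ {x Y Y′} → remainder d ≡ Y ∷ʳ x → remainder d′ ≡ Y′ ∷ʳ x →
    squeeze (entry d) x ≢ squeeze (entry d′) x → reduct d ≢ reduct d′
  reducts-differ-at-last {x} {Y} {Y′} eq eq′ x≢ d≡d′ =
    x≢ (∷ʳ-injectiveʳ (map (squeeze (entry d)) Y) (map (squeeze (entry d′)) Y′) (begin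
    map (squeeze (entry d)) Y ∷ʳ squeeze (entry d) x       ≡⟨ map-++ (squeeze (entry d)) Y (x ∷ []) ⟨
    map (squeeze (entry d)) (Y ∷ʳ x)                       ≡⟨ cong (map (squeeze (entry d))) eq ⟨
    reduct d                                               ≡⟨ d≡d′ ⟩
    reduct d′                                              ≡⟨ cong (map (squeeze (entry d′))) eq′ ⟩
    map (squeeze (entry d′)) (Y′ ∷ʳ x)                     ≡⟨ map-++ (squeeze (entry d′)) Y′ (x ∷ []) ⟩
    map (squeeze (entry d′)) Y′ ∷ʳ squeeze (entry d′) x    ∎))
    where open ≡-Reasoning

module _ {π : List ℕ} (p : IsPerm π) (d : Deletion π) where
  open Deletion d renaming (before to P; entry to v; after to S)

  remainder-≢entry : ∀ {x} → x ∈ remainder d → x ≢ v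
  remainder-≢entry x∈ refl with ∈-++⁻ P x∈ | unique-∉-around (Permutation.unique p) P v S split
  ... | inj₁ v∈P | v∉P , _ = v∉P v∈P
  ... | inj₂ v∈S | _ , v∉S = v∉S v∈S

  reduct-isPerm : IsPerm (reduct d) × length (reduct d) ≡ length π ∸ 1
  reduct-isPerm = proj₁ perm , trans (proj₂ perm) (cong (_∸ 1) (sym n≡))
    where
    v<n = Permutation.<length p (subst (v ∈_) (sym split) (∈-++⁺ʳ P (here refl)))
    k = length π ∸ suc v
    n≡ : length π ≡ suc (v + k)
    n≡ = sym (m+[n∸m]≡n v<n)
    upTo≡ : upTo (length π) ≡ interval 0 v ++ v ∷ interval (suc v) k
    upTo≡ = trans (upTo≡interval (length π))
      (trans (cong (interval 0) (trans n≡ (sym (+-suc v k)))) (interval-++ 0 v (suc k)))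
    remainder↭ : P ++ S ↭ interval 0 v ++ interval (suc v) k
    remainder↭ = drop-mid P (interval 0 v) (subst₂ _↭_ split upTo≡ p)
    squeezed : map (squeeze v) (interval 0 v ++ interval (suc v) k) ≡ interval 0 (v + k)
    squeezed = begin
      map (squeeze v) (interval 0 v ++ interval (suc v) k)                 ≡⟨ map-++ (squeeze v) (interval 0 v) _ ⟩
      map (squeeze v) (interval 0 v) ++ map (squeeze v) (interval (suc v) k)
        ≡⟨ cong₂ _++_ (map-squeeze-below v 0 v ≤-refl) (map-squeeze-above v v k ≤-refl) ⟩
      interval 0 v ++ interval v k                                          ≡⟨ interval-++ 0 v k ⟨
      interval 0 (v + k)                                                    ∎
      where open ≡-Reasoning
    perm = ↭-interval⇒isPerm (subst (reduct d ↭_) squeezed (map⁺ (squeeze v) remainder↭))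

  reduct-sumIndecomposable : ¬ Cut (remainder d) → SumIndecomposable (reduct d)
  reduct-sumIndecomposable ¬cut =
    ¬cut⇒sumIndecomposable (proj₁ reduct-isPerm) (¬cut ∘ cut-map⁻ (squeeze v) (squeeze-cancel-< v) (P ++ S))

  reduct-≼ : reduct d ≼ π
  reduct-≼ = P ++ S , subst (P ++ S ⊆_) (sym split) (⊆-drop P) , sym (length-map (squeeze v) (P ++ S)) ,
    λ x∈ y∈ → order (zip-map x∈) (zip-map y∈)
    where
    ⊆-drop : ∀ P → P ++ S ⊆ P ++ v ∷ S
    ⊆-drop []      = v skip ⊆-refl
    ⊆-drop (_ ∷ P) = refl ∷ ⊆-drop P
    zip-map : ∀ {xs x y} → (x , y) ∈ zip xs (map (squeeze v) xs) → x ∈ xs × y ≡ squeeze v x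
    zip-map {_ ∷ _} (here refl) = here refl , refl
    zip-map {_ ∷ _} (there q)   = map₁ there (zip-map q)
    order : ∀ {x y x′ y′} → x ∈ P ++ S × y ≡ squeeze v x → x′ ∈ P ++ S × y′ ≡ squeeze v x′ →
      (x < x′ → y < y′) × (y < y′ → x < x′)
    order (x∈ , refl) (x′∈ , refl) =
      (λ x<x′ → squeeze-mono-< v x<x′ (remainder-≢entry x∈) (remainder-≢entry x′∈)) , squeeze-cancel-< v

Succeeds : ∀ {π} → Deletion π → Set
Succeeds d = ¬ Cut (remainder d)

Exceptional : List ℕ → ℕ → Set
Exceptional π n = π ≡ decr n ⊎ π ≡ incr (n ∸ 1) ⊖ (0 ∷ []) ⊎ π ≡ (0 ∷ []) ⊖ incr (n ∸ 1)

TwoReducts : List ℕ → ℕ → Set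
TwoReducts π n = ∃₂ λ σ₁ σ₂ → σ₁ ≢ σ₂ ×
  length σ₁ ≡ n ∸ 1 × SumIndecomposable σ₁ × σ₁ ≼ π ×
  length σ₂ ≡ n ∸ 1 × SumIndecomposable σ₂ × σ₂ ≼ π

module _ {π : List ℕ} (p : IsPerm π) (d d′ : Deletion π) (ok : Succeeds d) (ok′ : Succeeds d′) where

  two-reducts : reduct d ≢ reduct d′ → TwoReducts π (length π)
  two-reducts d≢d′ = reduct d , reduct d′ , d≢d′ ,
    proj₂ (reduct-isPerm p d) , reduct-sumIndecomposable p d ok , reduct-≼ p d ,
    proj₂ (reduct-isPerm p d′) , reduct-sumIndecomposable p d′ ok′ , reduct-≼ p d′

  two-reducts-unless : (reduct d ≡ reduct d′ → Exceptional π (length π)) →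
    Exceptional π (length π) ⊎ TwoReducts π (length π)
  two-reducts-unless exceptional with ≡-dec _≟_ (reduct d) (reduct d′)
  ... | yes d≡d′ = inj₁ (exceptional d≡d′)
  ... | no  d≢d′ = inj₂ (two-reducts d≢d′)

-- Deleting an extreme entry

-- The extreme entries of π are addressed through the splittings π ≡ f ∷ T (first entry),
-- π ≡ I ∷ʳ ℓ (last entry), π ≡ PX ++ M ∷ SX (the maximum) and π ≡ PN ++ 0 ∷ SN (the minimum).
module ExtremeDeletions {π : List ℕ} (p : IsPerm π) (¬cut : ¬ Cut π)
                {M : ℕ} (M+1≡n : suc M ≡ length π) (2≤n : 2 ≤ length π) where

  open Permutation p

  ≤M : ∀ {x} → x ∈ π → x ≤ M
  ≤M = ≤max M+1≡n

  ≢singleton : ∀ {x} → π ≢ x ∷ []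
  ≢singleton π≡ = <-irrefl refl (subst (2 ≤_) (cong length π≡) 2≤n)

  ∈π : ∀ A {B x} → π ≡ A ++ B → x ∈ A → x ∈ π
  ∈π A eq x∈A = subst (_ ∈_) (sym eq) (∈-++⁺ˡ x∈A)

  ∈π′ : ∀ A {B x} → π ≡ A ++ B → x ∈ B → x ∈ π
  ∈π′ A eq x∈B = subst (_ ∈_) (sym eq) (∈-++⁺ʳ A x∈B)

  ≢0-if-before : ∀ P {S x} → π ≡ P ++ 0 ∷ S → x ∈ P → x ≢ 0
  ≢0-if-before P eN x∈P refl = proj₁ (unique-∉-around unique P 0 _ eN) x∈P

  ≢0-if-after : ∀ P {S x} → π ≡ P ++ 0 ∷ S → x ∈ S → x ≢ 0
  ≢0-if-after P {S} eN x∈S refl = proj₂ (unique-∉-around unique P 0 S eN) x∈S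

  max-not-last : ∀ PX SX → π ≡ PX ++ M ∷ SX → SX ≢ []
  max-not-last []       [] eq refl = ≢singleton eq
  max-not-last (a ∷ PX) [] eq refl = ¬cut (cut (a ∷ PX) (M ∷ []) eq (λ ()) (λ ()) below-M)
    where
    below-M : a ∷ PX ≺ M ∷ []
    below-M x∈ (here refl) =
      ≤∧≢⇒< (≤M (∈π (a ∷ PX) eq x∈)) (λ { refl → proj₁ (unique-∉-around unique (a ∷ PX) M [] eq) x∈ })

  min-not-first : ∀ PN SN → π ≡ PN ++ 0 ∷ SN → PN ≢ []
  min-not-first [] []       eq refl = ≢singleton eq
  min-not-first [] (s ∷ SN) eq refl = ¬cut (cut (0 ∷ []) (s ∷ SN) eq (λ ()) (λ ()) above-0)
    where
    above-0 : 0 ∷ [] ≺ s ∷ SN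
    above-0 (here refl) y∈ = n≢0⇒n>0 (λ { refl → proj₂ (unique-∉-around unique [] 0 (s ∷ SN) eq) y∈ })

  max-first⇒min-deletion-succeeds : ∀ SX PN SN → π ≡ M ∷ SX → π ≡ PN ++ 0 ∷ SN → ¬ Cut (PN ++ SN)
  max-first⇒min-deletion-succeeds SX []       SN eX eN = ⊥-elim (min-not-first [] SN eN refl)
  max-first⇒min-deletion-succeeds SX (x ∷ PN) SN eX eN with refl , _ ← ∷-injective (trans (sym eX) eN) =
    ¬cut-max-first M (PN ++ SN) λ y∈ → ≤M (∈-++-around y∈)
    where
    ∈-++-around : ∀ {y} → y ∈ PN ++ SN → y ∈ π
    ∈-++-around y∈ with ∈-++⁻ PN y∈
    ... | inj₁ y∈PN = ∈π (M ∷ PN) eN (there y∈PN)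
    ... | inj₂ y∈SN = ∈π′ (M ∷ PN) eN (there y∈SN)

  -- If no entry of the upper part B of the cut of T lies below f, then (f ∷ A, B) cuts π.
  -- Otherwise such an entry b < f comes after 0.  A cut of PN ++ SN falling before 0 would put
  -- f below b; one falling after 0 becomes a cut of π once 0 joins its lower part.
  first-min-deletions-not-both-cut : ∀ f T PN SN → π ≡ f ∷ T → π ≡ PN ++ 0 ∷ SN →
    Cut T → Cut (PN ++ SN) → ⊥
  first-min-deletions-not-both-cut f T PN SN eF eN
    (cut A B refl A≢[] B≢[] A≺B) (cut A′ B′ eq′ A′≢[] B′≢[] A′≺B′)
    with any? (_<? f) B
  ... | no none-below = ¬cut (cut (f ∷ A) B eF (λ ()) B≢[] f∷A≺B)
    where
    f∷A≺B : f ∷ A ≺ B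
    f∷A≺B (here refl) b∈B = ≤∧≢⇒< (≮⇒≥ (none-below ∘ lose b∈B))
      (λ { refl → unique-disjoint unique (f ∷ A) B eF (here refl) b∈B })
    f∷A≺B (there a∈A) b∈B = A≺B a∈A b∈B
  ... | yes some-below with b , b∈B , b<f ← find some-below with levi PN SN A′ B′ eq′
  ...   | inj₁ (C , refl , refl) = <-asym b<f (A′≺B′ f∈A′ (∈-++⁺ʳ C b∈SN))
    where
    0∈f∷A : 0 ∈ f ∷ A
    0∈f∷A with ∈-++⁻ (f ∷ A) (subst (0 ∈_) eF (∈π′ (A′ ++ C) eN (here refl)))
    ... | inj₁ 0∈    = 0∈
    ... | inj₂ 0∈B   = ⊥-elim (0∉upper A≢[] A≺B 0∈B)
    b∈SN : b ∈ SN
    b∈SN = ∈-after unique (A′ ++ C) 0 SN (f ∷ A) B eN eF 0∈f∷A b∈B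
    f∈A′ : f ∈ A′
    f∈A′ = head∈prefix A′ (trans (sym (++-assoc A′ C (0 ∷ SN))) (trans (sym eN) eF)) A′≢[]
  ...   | inj₂ (C , refl , refl) = ¬cut (cut (PN ++ 0 ∷ C) B′ eπ (++∷≢[] PN 0 C) B′≢[] PN0C≺B′)
    where
    eπ : π ≡ (PN ++ 0 ∷ C) ++ B′
    eπ = trans eN (sym (++-assoc PN (0 ∷ C) B′))
    PN0C≺B′ : PN ++ 0 ∷ C ≺ B′
    PN0C≺B′ x∈ y∈B′ with ∈-++⁻ PN x∈
    ... | inj₁ x∈PN         = A′≺B′ (∈-++⁺ˡ x∈PN) y∈B′
    ... | inj₂ (there x∈C)  = A′≺B′ (∈-++⁺ʳ PN x∈C) y∈B′
    ... | inj₂ (here refl)  =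
      n≢0⇒n>0 (λ { refl → proj₂ (unique-∉-around unique PN 0 (C ++ B′) eN) (∈-++⁺ʳ C y∈B′) })

  -- Mirror image of the previous lemma, with the last entry and the maximum.
  last-max-deletions-not-both-cut : ∀ I ℓ PX SX → π ≡ I ∷ʳ ℓ → π ≡ PX ++ M ∷ SX →
    Cut I → Cut (PX ++ SX) → ⊥
  last-max-deletions-not-both-cut I ℓ PX SX eL eX
    (cut A B refl A≢[] B≢[] A≺B) (cut A′ B′ eq′ A′≢[] B′≢[] A′≺B′)
    with any? (ℓ <?_) A
  ... | no none-above = ¬cut (cut A (B ∷ʳ ℓ) eπ A≢[] (++∷≢[] B ℓ []) A≺Bℓ)
    where
    eπ : π ≡ A ++ (B ∷ʳ ℓ)
    eπ = trans eL (++-assoc A B (ℓ ∷ []))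
    A≺Bℓ : A ≺ B ∷ʳ ℓ
    A≺Bℓ a∈A y∈ with ∈-++⁻ B y∈
    ... | inj₁ y∈B       = A≺B a∈A y∈B
    ... | inj₂ (here refl) = ≤∧≢⇒< (≮⇒≥ (none-above ∘ lose a∈A))
      (λ { refl → unique-disjoint unique A (B ∷ʳ ℓ) eπ a∈A (∈-++⁺ʳ B (here refl)) })
  ... | yes some-above with a , a∈A , ℓ<a ← find some-above with levi PX SX A′ B′ eq′
  ...   | inj₁ (C , refl , refl) = ¬cut (cut A′ (C ++ M ∷ SX) eπ A′≢[] (++∷≢[] C M SX) A′≺CMSX)
    where
    eπ : π ≡ A′ ++ (C ++ M ∷ SX)
    eπ = trans eX (++-assoc A′ C (M ∷ SX))
    A′≺CMSX : A′ ≺ C ++ M ∷ SX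
    A′≺CMSX x∈A′ y∈ with ∈-++⁻ C y∈
    ... | inj₁ y∈C          = A′≺B′ x∈A′ (∈-++⁺ˡ y∈C)
    ... | inj₂ (there y∈SX) = A′≺B′ x∈A′ (∈-++⁺ʳ C y∈SX)
    ... | inj₂ (here refl)  = ≤∧≢⇒< (≤M (∈π A′ eπ x∈A′))
      (λ { refl → unique-disjoint unique A′ (C ++ M ∷ SX) eπ x∈A′ (∈-++⁺ʳ C (here refl)) })
  ...   | inj₂ (C , refl , refl) = <-asym ℓ<a (A′≺B′ (∈-++⁺ˡ a∈PX) ℓ∈B′)
    where
    eπ : π ≡ A ++ (B ∷ʳ ℓ)
    eπ = trans eL (++-assoc A B (ℓ ∷ []))
    M∈Bℓ : M ∈ B ∷ʳ ℓ
    M∈Bℓ with ∈-++⁻ A (subst (M ∈_) eπ (∈π′ PX eX (here refl)))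
    ... | inj₂ M∈ = M∈
    ... | inj₁ M∈A with b , b∈B , M<b ← ≺-witness B≢[] A≺B M∈A =
      ⊥-elim (<⇒≱ M<b (≤M (∈π (A ++ B) eL (∈-++⁺ʳ A b∈B))))
    a∈PX : a ∈ PX
    a∈PX = ∈-before unique PX M (C ++ B′) A (B ∷ʳ ℓ) eX eπ a∈A M∈Bℓ
    ℓ∈B′ : ℓ ∈ B′
    ℓ∈B′ = last∈suffix (PX ++ M ∷ C) B′ (A ++ B) ℓ
      (trans (++-assoc PX (M ∷ C) B′) (trans (sym eX) eL)) B′≢[]

  Result : Set
  Result = Exceptional π (length π) ⊎ TwoReducts π (length π)

  M≢0 : M ≢ 0
  M≢0 M≡0 = <-irrefl refl (subst (2 ≤_) (trans (sym M+1≡n) (cong suc M≡0)) 2≤n)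

  squeeze-max≢squeeze-0 : ∀ {x} → x ∈ π → x ≢ 0 → squeeze M x ≢ squeeze 0 x
  squeeze-max≢squeeze-0 x∈ x≢0 eq = squeeze-<-≤-distinct (n≢0⇒n>0 x≢0) (≤M x∈) (sym eq)

  max-first-min-last⇒decreasing : ∀ Q (eX : π ≡ [] ++ M ∷ (Q ∷ʳ 0)) (eN : π ≡ (M ∷ Q) ++ 0 ∷ []) →
    reduct (deletion [] M (Q ∷ʳ 0) eX) ≡ reduct (deletion (M ∷ Q) 0 [] eN) → π ≡ decr (length π)
  max-first-min-last⇒decreasing Q eX eN same = begin
    π                             ≡⟨ eX ⟩
    M ∷ Q ∷ʳ 0                    ≡⟨ cong (M ∷_) (shift-down⇒downFrom (pred M) Q 0∉Q shifted) ⟩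
    M ∷ downFrom (suc (pred M))   ≡⟨ cong (λ m → M ∷ downFrom m) (suc-pred M ⦃ ≢-nonZero M≢0 ⦄) ⟩
    downFrom (suc M)              ≡⟨ cong downFrom M+1≡n ⟩
    decr (length π)               ∎
    where
    open ≡-Reasoning
    0∉Q : 0 ∉ Q
    0∉Q = proj₁ (unique-∉-around unique (M ∷ Q) 0 [] eN) ∘ there
    shifted : Q ∷ʳ 0 ≡ pred M ∷ map pred Q
    shifted = begin
      Q ∷ʳ 0                          ≡⟨ map-id-local (All.tabulate (squeeze-≤ ∘ ≤M ∘ ∈π′ (M ∷ []) eX)) ⟨
      map (squeeze M) (Q ∷ʳ 0)        ≡⟨ same ⟩
      map (squeeze 0) (M ∷ Q ++ [])   ≡⟨ cong (λ t → map (squeeze 0) (M ∷ t)) (++-identityʳ Q) ⟩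
      map (squeeze 0) (M ∷ Q)         ≡⟨ map-cong squeeze-zero (M ∷ Q) ⟩
      map pred (M ∷ Q)                ∎

  max-and-min-deletions-succeed : ∀ {f T I ℓ PX SX PN SN} → π ≡ f ∷ T → π ≡ I ∷ʳ ℓ →
    (eX : π ≡ PX ++ M ∷ SX) (eN : π ≡ PN ++ 0 ∷ SN) → ¬ Cut (PX ++ SX) → ¬ Cut (PN ++ SN) → Result
  max-and-min-deletions-succeed {f} {T} {I} {ℓ} {PX} {SX} {PN} {SN} eF eL eX eN okX okN
    with viewHead PX M SX eF eX | viewHead PN 0 SN eF eN
  ... | _ | inj₁ (refl , _ , _) = ⊥-elim (min-not-first [] SN eN refl)
  ... | inj₂ (Q , refl , _) | inj₂ (PN′ , refl , _) =
    inj₂ (two-reducts p X N okX okN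
      (reducts-differ-at-head X N refl refl
        (squeeze-max≢squeeze-0 (∈π (f ∷ []) eF (here refl)) (≢0-if-before (f ∷ PN′) eN (here refl)))))
    where
    X = deletion (f ∷ Q) M SX eX
    N = deletion (f ∷ PN′) 0 SN eN
  ... | inj₁ (refl , refl , refl) | inj₂ (PN′ , refl , refl)
    with viewLast (M ∷ PN′) 0 SN eL eN | viewLast [] M SX eL eX
  ...   | _                         | inj₁ (SX≡[] , _ , _) = ⊥-elim (max-not-last [] _ eX SX≡[])
  ...   | inj₁ (refl , refl , refl) | _                    =
    two-reducts-unless p (deletion [] M _ eX) (deletion (M ∷ PN′) 0 [] eN) okX okN
      (inj₁ ∘ max-first-min-last⇒decreasing PN′ eX eN)
  ...   | inj₂ (S′ , refl , _)      | inj₂ (SX′ , SX≡ , _) =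
    inj₂ (two-reducts p X N okX okN
      (reducts-differ-at-last X N {Y′ = M ∷ PN′ ++ S′} SX≡ (sym (++-assoc (M ∷ PN′) S′ (ℓ ∷ [])))
        (squeeze-max≢squeeze-0 (∈π′ I eL (here refl)) (≢0-if-after (M ∷ PN′) eN (∈-++⁺ʳ S′ (here refl))))))
    where
    X = deletion [] M _ eX
    N = deletion (M ∷ PN′) 0 (S′ ∷ʳ ℓ) eN

  run-then-0⇒incr⊖1 : ∀ f K → f ≢ 0 → π ≡ f ∷ interval (suc f) K ∷ʳ 0 →
    π ≡ incr (length π ∸ 1) ⊖ (0 ∷ [])
  run-then-0⇒incr⊖1 f K f≢0 eπ = begin
    π                               ≡⟨ eπ ⟩
    f ∷ interval (suc f) K ∷ʳ 0     ≡⟨ cong (λ t → t ∷ interval (suc t) K ∷ʳ 0) f≡1 ⟩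
    interval 1 (suc K) ∷ʳ 0         ≡⟨ incr⊖1 (suc K) ⟨
    incr (suc K) ⊖ (0 ∷ [])         ≡⟨ cong (λ t → incr t ⊖ (0 ∷ [])) |π|∸1≡ ⟨
    incr (length π ∸ 1) ⊖ (0 ∷ [])  ∎
    where
    open ≡-Reasoning
    |π|∸1≡ : length π ∸ 1 ≡ suc K
    |π|∸1≡ = cong (_∸ 1) (trans (cong length eπ)
      (cong suc (trans (length-++ (interval (suc f) K)) (trans (cong (_+ 1) (length-interval (suc f) K)) (+-comm K 1)))))
    f≡1 : f ≡ 1
    f≡1 with ∈-++⁻ (f ∷ interval (suc f) K) (subst (1 ∈_) eπ (∈-of-<length 2≤n))
    ... | inj₁ (here 1≡f)   = sym 1≡f
    ... | inj₁ (there 1∈)   = ⊥-elim (f≢0 (n≤0⇒n≡0 (s≤s⁻¹ (proj₁ (∈-interval⁻ 1∈)))))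
    ... | inj₂ (here ())

  first-max-reducts-equal⇒incr⊖1 : ∀ f Q SX′
    (eF : π ≡ f ∷ Q ++ M ∷ SX′ ∷ʳ 0) (eX : π ≡ (f ∷ Q) ++ M ∷ SX′ ∷ʳ 0) →
    Cut (f ∷ Q ++ M ∷ SX′) →
    reduct (deletion [] f (Q ++ M ∷ SX′ ∷ʳ 0) eF) ≡ reduct (deletion (f ∷ Q) M (SX′ ∷ʳ 0) eX) →
    π ≡ incr (length π ∸ 1) ⊖ (0 ∷ [])
  first-max-reducts-equal⇒incr⊖1 f Q SX′ eF eX cutN same = run-then-0⇒incr⊖1 f (suc (length Q)) f≢0 (begin
    π                                          ≡⟨ eX ⟩
    f ∷ Q ++ M ∷ SX′ ∷ʳ 0                      ≡⟨ cong (λ t → f ∷ Q ++ M ∷ t ∷ʳ 0) SX′≡[] ⟩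
    f ∷ Q ++ M ∷ 0 ∷ []                        ≡⟨ cong (f ∷_) (++-assoc Q (M ∷ []) (0 ∷ [])) ⟨
    f ∷ (Q ∷ʳ M) ∷ʳ 0                          ≡⟨ cong (λ t → f ∷ t ∷ʳ 0) (proj₁ run) ⟩
    f ∷ interval (suc f) (suc (length Q)) ∷ʳ 0 ∎)
    where
    open ≡-Reasoning
    SX = SX′ ∷ʳ 0
    f≢0 : f ≢ 0
    f≢0 = ≢0-if-before (f ∷ Q ++ M ∷ SX′) (trans eX (sym (++-assoc (f ∷ Q) (M ∷ SX′) (0 ∷ [])))) (here refl)
    f∉Q++MSX : f ∉ Q ++ M ∷ SX
    f∉Q++MSX = unique-disjoint unique (f ∷ []) _ eF (here refl)
    ∈-remainder : ∀ {x} → x ∈ (f ∷ Q) ++ SX → x ∈ π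
    ∈-remainder x∈ with ∈-++⁻ (f ∷ Q) x∈
    ... | inj₁ x∈fQ = ∈π (f ∷ Q) eX x∈fQ
    ... | inj₂ x∈SX = ∈π′ (f ∷ Q ++ M ∷ []) (trans eX (sym (++-assoc (f ∷ Q) (M ∷ []) SX))) x∈SX
    run : Q ∷ʳ M ≡ interval (suc f) (suc (length Q)) × map (squeeze f) SX ≡ SX
    run = squeeze-shift⇒interval f f Q M SX ≤-refl
      (λ { refl → f∉Q++MSX (∈-++⁺ʳ Q (here refl)) })
      (λ { y∈Q refl → f∉Q++MSX (∈-++⁺ˡ y∈Q) })
      (trans same (map-id-local (All.tabulate (squeeze-≤ ∘ ≤M ∘ ∈-remainder))))
    SX′≡[] : SX′ ≡ []
    SX′≡[] with initLast SX′
    ... | []       = refl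
    ... | R ∷ʳ′ r  =
      ⊥-elim (<⇒≱ f<r (squeeze-fixed⇒≤ (map-fixed (squeeze f) (proj₂ run) (∈-++⁺ˡ (∈-++⁺ʳ R (here refl))))))
      where
      f<r : f < r
      f<r = cut⇒head<last f _ (f ∷ Q ++ M ∷ R) r (sym (++-assoc (f ∷ Q) (M ∷ R) (r ∷ []))) cutN

  only-max-deletion-succeeds : ∀ {f T I ℓ PX SX PN SN} (eF : π ≡ f ∷ T) (eL : π ≡ I ∷ʳ ℓ) →
    (eX : π ≡ PX ++ M ∷ SX) (eN : π ≡ PN ++ 0 ∷ SN) → ¬ Cut (PX ++ SX) → Cut (PN ++ SN) → Result
  only-max-deletion-succeeds {f} {T} {I} {ℓ} {PX} {SX} {PN} {SN} eF eL eX eN okX cutN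
    with viewHead PX M SX eF eX | viewHead PN 0 SN eF eN
  ... | inj₁ (refl , refl , refl) | _ = ⊥-elim (max-first⇒min-deletion-succeeds SX PN SN eX eN cutN)
  ... | _ | inj₁ (refl , _ , _) = ⊥-elim (min-not-first [] SN eN refl)
  ... | inj₂ (Q , refl , refl) | inj₂ (PN′ , refl , _)
    with viewLast (f ∷ PN′) 0 SN eL eN | viewLast (f ∷ Q) M SX eL eX
  ...   | _                    | inj₁ (SX≡[] , _ , _) = ⊥-elim (max-not-last (f ∷ Q) SX eX SX≡[])
  ...   | inj₂ (S′ , refl , _) | inj₂ (SX′ , refl , _) =
    inj₂ (two-reducts p F X okF okX (reducts-differ-at-last F X {Y = Q ++ M ∷ SX′} {Y′ = f ∷ Q ++ SX′}
      (sym (++-assoc Q (M ∷ SX′) (ℓ ∷ []))) (sym (++-assoc (f ∷ Q) SX′ (ℓ ∷ [])))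
      (squeeze-<-≤-distinct f<ℓ (≤M (∈π′ I eL (here refl))))))
    where
    F = deletion [] f (Q ++ M ∷ SX′ ∷ʳ ℓ) eF
    X = deletion (f ∷ Q) M (SX′ ∷ʳ ℓ) eX
    okF : ¬ Cut (remainder F)
    okF cutT = first-min-deletions-not-both-cut f _ (f ∷ PN′) (S′ ∷ʳ ℓ) eF eN cutT cutN
    f<ℓ : f < ℓ
    f<ℓ = cut⇒head<last f _ (f ∷ PN′ ++ S′) ℓ (sym (++-assoc (f ∷ PN′) S′ (ℓ ∷ []))) cutN
  ...   | inj₁ (refl , refl , refl) | inj₂ (SX′ , refl , refl) =
    two-reducts-unless p F X okF okX
      (inj₂ ∘ inj₁ ∘ first-max-reducts-equal⇒incr⊖1 f Q SX′ eF eX (subst Cut (++-identityʳ _) cutN))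
    where
    F = deletion [] f (Q ++ M ∷ SX′ ∷ʳ 0) eF
    X = deletion (f ∷ Q) M (SX′ ∷ʳ 0) eX
    okF : ¬ Cut (remainder F)
    okF cutT = first-min-deletions-not-both-cut f _ (f ∷ Q ++ M ∷ SX′) [] eF eN cutT cutN

  min-last⇒max-deletion-succeeds : ∀ I PX SX → π ≡ I ∷ʳ 0 → π ≡ PX ++ M ∷ SX → ¬ Cut (PX ++ SX)
  min-last⇒max-deletion-succeeds I PX SX eL eX
    with SX′ , refl ← suffix-∷ʳ PX M SX I 0 (trans (sym eX) eL) (max-not-last PX SX eX) =
    subst (¬_ ∘ Cut) (++-assoc PX SX′ (0 ∷ [])) (¬cut-min-last (PX ++ SX′) 0 (λ _ → z≤n))

  max-then-run⇒1⊖incr : ∀ K → π ≡ M ∷ interval 0 K → π ≡ (0 ∷ []) ⊖ incr (length π ∸ 1)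
  max-then-run⇒1⊖incr K eπ = begin
    π                                   ≡⟨ eπ ⟩
    M ∷ interval 0 K                    ≡⟨ cong (_∷ interval 0 K) M≡K ⟩
    K ∷ interval 0 K                    ≡⟨ 1⊖incr K ⟨
    (0 ∷ []) ⊖ incr K
      ≡⟨ cong (λ t → (0 ∷ []) ⊖ incr (t ∸ 1)) (trans (cong suc (sym M≡K)) M+1≡n) ⟩
    (0 ∷ []) ⊖ incr (length π ∸ 1)      ∎
    where
    open ≡-Reasoning
    M≡K : M ≡ K
    M≡K = suc-injective (trans M+1≡n (trans (cong length eπ) (cong suc (length-interval 0 K))))

  max-first-last-min-reducts-equal⇒1⊖incr : ∀ Q S′ ℓ (eL : π ≡ (M ∷ Q ++ 0 ∷ S′) ∷ʳ ℓ)
    (eN : π ≡ (M ∷ Q) ++ 0 ∷ S′ ∷ʳ ℓ) → Cut (Q ++ 0 ∷ S′ ∷ʳ ℓ) →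
    reduct (deletion (M ∷ Q ++ 0 ∷ S′) ℓ [] eL) ≡ reduct (deletion (M ∷ Q) 0 (S′ ∷ʳ ℓ) eN) →
    π ≡ (0 ∷ []) ⊖ incr (length π ∸ 1)
  max-first-last-min-reducts-equal⇒1⊖incr (x ∷ Q) S′ ℓ eL eN cutX same =
    ⊥-elim (squeeze-<-≤-distinct (n≢0⇒n>0 x≢0) (<⇒≤ x<ℓ)
      (sym (proj₁ (∷-injective (proj₂ (∷-injective same))))))
    where
    x≢0 : x ≢ 0
    x≢0 = ≢0-if-before (M ∷ x ∷ Q) eN (there (here refl))
    x<ℓ : x < ℓ
    x<ℓ = cut⇒head<last x _ (x ∷ Q ++ 0 ∷ S′) ℓ (sym (++-assoc (x ∷ Q) (0 ∷ S′) (ℓ ∷ []))) cutX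
  max-first-last-min-reducts-equal⇒1⊖incr [] S′ ℓ eL eN _ same =
    max-then-run⇒1⊖incr (suc (suc (length S′))) (trans eN (cong (λ t → M ∷ 0 ∷ t) run))
    where
    open ≡-Reasoning
    ℓ≢0 : ℓ ≢ 0
    ℓ≢0 = ≢0-if-after (M ∷ []) eN (∈-++⁺ʳ S′ (here refl))
    shifted : 0 ∷ map (squeeze ℓ) S′ ≡ map pred (S′ ∷ʳ ℓ)
    shifted = begin
      0 ∷ map (squeeze ℓ) S′                  ≡⟨ cong (_∷ map (squeeze ℓ) S′) (squeeze-≤ {ℓ} z≤n) ⟨
      map (squeeze ℓ) (0 ∷ S′)                ≡⟨ cong (map (squeeze ℓ)) (++-identityʳ (0 ∷ S′)) ⟨
      map (squeeze ℓ) ((0 ∷ S′) ++ [])        ≡⟨ proj₂ (∷-injective same) ⟩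
      map (squeeze 0) (S′ ∷ʳ ℓ)               ≡⟨ map-cong squeeze-zero (S′ ∷ʳ ℓ) ⟩
      map pred (S′ ∷ʳ ℓ)                      ∎
    run : S′ ∷ʳ ℓ ≡ interval 1 (suc (length S′))
    run = pred-shift⇒interval ℓ 0 S′ (n≢0⇒n>0 ℓ≢0) (≢0-if-after (M ∷ []) eN ∘ ∈-++⁺ˡ)
      (λ { y∈ refl → unique-disjoint unique (M ∷ 0 ∷ S′) (ℓ ∷ []) (trans eN (sym (++-assoc (M ∷ 0 ∷ []) S′ (ℓ ∷ []))))
                       (there (there y∈)) (here refl) })
      shifted

  only-min-deletion-succeeds : ∀ {f T I ℓ PX SX PN SN} (eF : π ≡ f ∷ T) (eL : π ≡ I ∷ʳ ℓ) →
    (eX : π ≡ PX ++ M ∷ SX) (eN : π ≡ PN ++ 0 ∷ SN) → Cut (PX ++ SX) → ¬ Cut (PN ++ SN) → Result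
  only-min-deletion-succeeds {f} {T} {I} {ℓ} {PX} {SX} {PN} {SN} eF eL eX eN cutX okN with viewLast PN 0 SN eL eN
  ... | inj₁ (refl , refl , refl) = ⊥-elim (min-last⇒max-deletion-succeeds PN PX SX eL eX cutX)
  ... | inj₂ (S′ , refl , refl)
    with viewHead PX M SX eF eX | viewHead PN 0 (S′ ∷ʳ ℓ) eF eN | viewLast PX M SX eL eX
  ...   | _ | inj₁ (refl , _ , _) | _ = ⊥-elim (min-not-first [] (S′ ∷ʳ ℓ) eN refl)
  ...   | _ | _ | inj₁ (SX≡[] , _ , _) = ⊥-elim (max-not-last PX SX eX SX≡[])
  ...   | inj₂ (Q , refl , _) | inj₂ (PN′ , refl , _) | inj₂ (SX′ , refl , _) =
    inj₂ (two-reducts p L N okL okN (reducts-differ-at-head L N {Y = (PN′ ++ 0 ∷ S′) ++ []} refl refl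
      (λ eq → squeeze-<-≤-distinct (n≢0⇒n>0 (≢0-if-before (f ∷ PN′) eN (here refl))) (<⇒≤ f<ℓ) (sym eq))))
    where
    L = deletion (f ∷ PN′ ++ 0 ∷ S′) ℓ [] eL
    N = deletion (f ∷ PN′) 0 (S′ ∷ʳ ℓ) eN
    okL : ¬ Cut ((f ∷ PN′ ++ 0 ∷ S′) ++ [])
    okL cutL = last-max-deletions-not-both-cut _ ℓ (f ∷ Q) (SX′ ∷ʳ ℓ) eL eX (subst Cut (++-identityʳ _) cutL) cutX
    f<ℓ : f < ℓ
    f<ℓ = cut⇒head<last f _ (f ∷ Q ++ SX′) ℓ (sym (++-assoc (f ∷ Q) SX′ (ℓ ∷ []))) cutX
  ...   | inj₁ (refl , refl , refl) | inj₂ (Q , refl , refl) | _ =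
    two-reducts-unless p L N okL okN (inj₂ ∘ inj₂ ∘ max-first-last-min-reducts-equal⇒1⊖incr Q S′ ℓ eL eN cutX)
    where
    L = deletion (M ∷ Q ++ 0 ∷ S′) ℓ [] eL
    N = deletion (M ∷ Q) 0 (S′ ∷ʳ ℓ) eN
    okL : ¬ Cut ((M ∷ Q ++ 0 ∷ S′) ++ [])
    okL cutL = last-max-deletions-not-both-cut _ ℓ [] _ eL eX (subst Cut (++-identityʳ _) cutL) cutX

  <M-if-≢M : ∀ {x} → x ∈ π → x ≢ M → x < M
  <M-if-≢M x∈ x≢M = ≤∧≢⇒< (≤M x∈) x≢M

  squeeze-max : ∀ {v} → v < M → squeeze v M ≡ pred M
  squeeze-max {v} v<M = trans (cong (squeeze v) (sym M≡)) (squeeze-> (s≤s⁻¹ (subst (v <_) (sym M≡) v<M)))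
    where
    M≡ : suc (pred M) ≡ M
    M≡ = suc-pred M ⦃ ≢-nonZero M≢0 ⦄

  pred-max∉ : ∀ {v ys} → v < M → (∀ {y} → y ∈ ys → y ≢ v) → M ∉ ys → pred M ∉ map (squeeze v) ys
  pred-max∉ {v} v<M ≢v M∉ pM∈ with y , y∈ , pM≡ ← ∈-map⁻ (squeeze v) pM∈ =
    M∉ (subst (_∈ _) (squeeze-injective v (trans (sym pM≡) (sym (squeeze-max v<M))) (≢v y∈) (<⇒≢ v<M ∘ sym)) y∈)

  -- Both reducts keep the image pred M of the maximum, at positions |Q| and |Q| + 1.
  first-last-reducts-differ : ∀ f Q SX′ ℓ
    (eF : π ≡ f ∷ Q ++ M ∷ SX′ ∷ʳ ℓ) (eL : π ≡ (f ∷ Q ++ M ∷ SX′) ∷ʳ ℓ) →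
    reduct (deletion [] f (Q ++ M ∷ SX′ ∷ʳ ℓ) eF) ≢ reduct (deletion (f ∷ Q ++ M ∷ SX′) ℓ [] eL)
  first-last-reducts-differ f Q SX′ ℓ eF eL same =
    1+n≢n (sym (begin
      length Q                          ≡⟨ length-map (squeeze f) Q ⟨
      length (map (squeeze f) Q)        ≡⟨ position-unique _ _ _ _ (pred M) positions
                                             (pred-max∉ f<M f≢ (M∉fQ ∘ there)) (pred-max∉ ℓ<M ℓ≢ M∉fQ) ⟩
      length (map (squeeze ℓ) (f ∷ Q))  ≡⟨ cong suc (length-map (squeeze ℓ) Q) ⟩
      suc (length Q)                    ∎))
    where
    open ≡-Reasoning
    M∉fQ : M ∉ f ∷ Q
    M∉fQ = proj₁ (unique-∉-around unique (f ∷ Q) M (SX′ ∷ʳ ℓ) eF)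
    ℓ∈SX : ℓ ∈ SX′ ∷ʳ ℓ
    ℓ∈SX = ∈-++⁺ʳ SX′ (here refl)
    f<M : f < M
    f<M = <M-if-≢M (∈π (f ∷ []) eF (here refl)) (λ { refl → M∉fQ (here refl) })
    ℓ<M : ℓ < M
    ℓ<M = <M-if-≢M (∈π′ (f ∷ Q ++ M ∷ SX′) eL (here refl))
      (λ { refl → proj₂ (unique-∉-around unique (f ∷ Q) M (SX′ ∷ʳ ℓ) eF) ℓ∈SX })
    f≢ : ∀ {y} → y ∈ Q → y ≢ f
    f≢ y∈Q refl = unique-disjoint unique (f ∷ []) _ eF (here refl) (∈-++⁺ˡ y∈Q)
    ℓ≢ : ∀ {y} → y ∈ f ∷ Q → y ≢ ℓ
    ℓ≢ y∈ refl = unique-disjoint unique (f ∷ Q) (M ∷ SX′ ∷ʳ ℓ) eF y∈ (there ℓ∈SX)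
    positions : map (squeeze f) Q ++ pred M ∷ map (squeeze f) (SX′ ∷ʳ ℓ) ≡
                map (squeeze ℓ) (f ∷ Q) ++ pred M ∷ map (squeeze ℓ) (SX′ ++ [])
    positions = begin
      map (squeeze f) Q ++ pred M ∷ map (squeeze f) (SX′ ∷ʳ ℓ)
        ≡⟨ cong (λ t → map (squeeze f) Q ++ t ∷ _) (squeeze-max f<M) ⟨
      map (squeeze f) Q ++ map (squeeze f) (M ∷ SX′ ∷ʳ ℓ)
        ≡⟨ map-++ (squeeze f) Q _ ⟨
      reduct (deletion [] f (Q ++ M ∷ SX′ ∷ʳ ℓ) eF)
        ≡⟨ same ⟩
      map (squeeze ℓ) ((f ∷ Q ++ M ∷ SX′) ++ [])
        ≡⟨ cong (map (squeeze ℓ)) (++-assoc (f ∷ Q) (M ∷ SX′) []) ⟩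
      map (squeeze ℓ) ((f ∷ Q) ++ M ∷ SX′ ++ [])
        ≡⟨ map-++ (squeeze ℓ) (f ∷ Q) _ ⟩
      map (squeeze ℓ) (f ∷ Q) ++ squeeze ℓ M ∷ map (squeeze ℓ) (SX′ ++ [])
        ≡⟨ cong (λ t → map (squeeze ℓ) (f ∷ Q) ++ t ∷ _) (squeeze-max ℓ<M) ⟩
      map (squeeze ℓ) (f ∷ Q) ++ pred M ∷ map (squeeze ℓ) (SX′ ++ [])  ∎

  max-and-min-deletions-fail : ∀ {f T I ℓ PX SX PN SN} (eF : π ≡ f ∷ T) (eL : π ≡ I ∷ʳ ℓ) →
    (eX : π ≡ PX ++ M ∷ SX) (eN : π ≡ PN ++ 0 ∷ SN) → Cut (PX ++ SX) → Cut (PN ++ SN) → Result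
  max-and-min-deletions-fail {f} {T} {I} {ℓ} {PX} {SX} {PN} {SN} eF eL eX eN cutX cutN
    with viewHead PX M SX eF eX
  ... | inj₁ (refl , refl , refl) = ⊥-elim (max-first⇒min-deletion-succeeds SX PN SN eX eN cutN)
  ... | inj₂ (Q , refl , refl) with viewLast (f ∷ Q) M SX eL eX
  ...   | inj₁ (SX≡[] , _ , _)     = ⊥-elim (max-not-last (f ∷ Q) SX eX SX≡[])
  ...   | inj₂ (SX′ , refl , refl) =
    inj₂ (two-reducts p (deletion [] f _ eF) (deletion _ ℓ [] eL) okF okL (first-last-reducts-differ f Q SX′ ℓ eF eL))
    where
    okF : ¬ Cut (Q ++ M ∷ SX′ ∷ʳ ℓ)
    okF cutT = first-min-deletions-not-both-cut f _ PN SN eF eN cutT cutN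
    okL : ¬ Cut ((f ∷ Q ++ M ∷ SX′) ++ [])
    okL cutL = last-max-deletions-not-both-cut _ ℓ (f ∷ Q) _ eL eX (subst Cut (++-identityʳ _) cutL) cutX

  exceptional-or-two-reducts : ∀ {f T I ℓ PX SX PN SN} →
    π ≡ f ∷ T → π ≡ I ∷ʳ ℓ → π ≡ PX ++ M ∷ SX → π ≡ PN ++ 0 ∷ SN → Result
  exceptional-or-two-reducts {PX = PX} {SX} {PN} {SN} eF eL eX eN with cut? (PX ++ SX) | cut? (PN ++ SN)
  ... | no  okX  | no  okN  = max-and-min-deletions-succeed eF eL eX eN okX okN
  ... | no  okX  | yes cutN = only-max-deletion-succeeds eF eL eX eN okX cutN
  ... | yes cutX | no  okN  = only-min-deletion-succeeds eF eL eX eN cutX okN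
  ... | yes cutX | yes cutN = max-and-min-deletions-fail eF eL eX eN cutX cutN

sumIndecomposable⇒exceptional-or-two-reducts : ∀ π → SumIndecomposable π →
  Exceptional π (length π) ⊎ TwoReducts π (length π)
sumIndecomposable⇒exceptional-or-two-reducts []       _       = inj₁ (inj₁ refl)
sumIndecomposable⇒exceptional-or-two-reducts (x ∷ []) (p , _) with s≤s z≤n ← ∈-upTo⁻ (∈-resp-↭ p (here refl)) =
  inj₁ (inj₁ refl)
sumIndecomposable⇒exceptional-or-two-reducts π@(f ∷ y ∷ T) si@(p , _)
  with I , ℓ , eL ← ∃-init-last π (λ ())
  with PX , SX , eX ← ∈-∃++ (Permutation.∈-of-<length p (n<1+n (suc (length T))))
  with PN , SN , eN ← ∈-∃++ (Permutation.∈-of-<length p {0} (s≤s z≤n)) =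
  ExtremeDeletions.exceptional-or-two-reducts p (sumIndecomposable⇒¬cut si) refl (s≤s (s≤s z≤n)) refl eL eX eN

-- Permutation classes

exceptional-deletion : ∀ k {π} → IsPerm π → Exceptional π (4 + k) → Σ (Deletion π) Succeeds
exceptional-deletion k p (inj₁ refl) =
  deletion [] _ _ refl , ¬cut-max-first (2 + k) (downFrom (2 + k)) (<⇒≤ ∘ ∈-downFrom⁻)
exceptional-deletion k p (inj₂ (inj₁ refl)) =
  deletion [] 1 _ refl , ¬cut-min-last (map (_+ 1) (applyUpTo suc (2 + k))) 0 (λ _ → z≤n)
exceptional-deletion k p (inj₂ (inj₂ refl)) =
  deletion (_ ∷ []) 0 _ refl , ¬cut-max-first _ _ (λ x∈ → Permutation.≤max p refl (there (there x∈)))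

exceptional-reducts-distinct : ∀ k {π₁ π₂} (p₁ : IsPerm π₁) (p₂ : IsPerm π₂)
  (e₁ : Exceptional π₁ (4 + k)) (e₂ : Exceptional π₂ (4 + k)) → π₁ ≢ π₂ →
  reduct (proj₁ (exceptional-deletion k p₁ e₁)) ≢ reduct (proj₁ (exceptional-deletion k p₂ e₂))
exceptional-reducts-distinct k p₁ p₂ (inj₁ refl)        (inj₁ refl)        π₁≢π₂ = ⊥-elim (π₁≢π₂ refl)
exceptional-reducts-distinct k p₁ p₂ (inj₁ refl)        (inj₂ (inj₁ refl)) _     ()
exceptional-reducts-distinct k p₁ p₂ (inj₁ refl)        (inj₂ (inj₂ refl)) _     ()
exceptional-reducts-distinct k p₁ p₂ (inj₂ (inj₁ refl)) (inj₁ refl)        _     ()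
exceptional-reducts-distinct k p₁ p₂ (inj₂ (inj₁ refl)) (inj₂ (inj₁ refl)) π₁≢π₂ = ⊥-elim (π₁≢π₂ refl)
exceptional-reducts-distinct k p₁ p₂ (inj₂ (inj₁ refl)) (inj₂ (inj₂ refl)) _     ()
exceptional-reducts-distinct k p₁ p₂ (inj₂ (inj₂ refl)) (inj₁ refl)        _     ()
exceptional-reducts-distinct k p₁ p₂ (inj₂ (inj₂ refl)) (inj₂ (inj₁ refl)) _     ()
exceptional-reducts-distinct k p₁ p₂ (inj₂ (inj₂ refl)) (inj₂ (inj₂ refl)) π₁≢π₂ = ⊥-elim (π₁≢π₂ refl)

TwoMembers : PermClass → ℕ → Set
TwoMembers C n = ∃₂ λ σ₁ σ₂ → σ₁ ≢ σ₂ ×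
  mem C σ₁ × length σ₁ ≡ n × SumIndecomposable σ₁ ×
  mem C σ₂ × length σ₂ ≡ n × SumIndecomposable σ₂

module _ (C : PermClass) where

  two-reducts⇒two-members : ∀ {π n} → mem C π → length π ≡ n → TwoReducts π n → TwoMembers C (n ∸ 1)
  two-reducts⇒two-members π∈C _ (σ₁ , σ₂ , σ₁≢σ₂ , |σ₁| , si₁ , σ₁≼π , |σ₂| , si₂ , σ₂≼π) =
    σ₁ , σ₂ , σ₁≢σ₂ ,
    downset C π∈C (proj₁ si₁) σ₁≼π , |σ₁| , si₁ ,
    downset C π∈C (proj₁ si₂) σ₂≼π , |σ₂| , si₂

  distinct-deletions⇒two-members : ∀ {π₁ π₂ n} → mem C π₁ → mem C π₂ → length π₁ ≡ n → length π₂ ≡ n →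
    IsPerm π₁ → IsPerm π₂ → ((d₁ , _) : Σ (Deletion π₁) Succeeds) ((d₂ , _) : Σ (Deletion π₂) Succeeds) →
    reduct d₁ ≢ reduct d₂ → TwoMembers C (n ∸ 1)
  distinct-deletions⇒two-members π₁∈C π₂∈C refl |π₂| p₁ p₂ (d₁ , ok₁) (d₂ , ok₂) d₁≢d₂ =
    reduct d₁ , reduct d₂ , d₁≢d₂ ,
    downset C π₁∈C (proj₁ si₁) (reduct-≼ p₁ d₁) , proj₂ (reduct-isPerm p₁ d₁) , si₁ ,
    downset C π₂∈C (proj₁ si₂) (reduct-≼ p₂ d₂) ,
    trans (proj₂ (reduct-isPerm p₂ d₂)) (cong (_∸ 1) |π₂|) , si₂
    where
    si₁ = reduct-sumIndecomposable p₁ d₁ ok₁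
    si₂ = reduct-sumIndecomposable p₂ d₂ ok₂

  two-members⇒two-members-shorter : ∀ n → 4 ≤ n → TwoMembers C n → TwoMembers C (n ∸ 1)
  two-members⇒two-members-shorter _ (s≤s (s≤s (s≤s (s≤s {n = k} z≤n))))
    (π₁ , π₂ , π₁≢π₂ , π₁∈C , |π₁| , si₁ , π₂∈C , |π₂| , si₂)
    with sumIndecomposable⇒exceptional-or-two-reducts π₁ si₁ | sumIndecomposable⇒exceptional-or-two-reducts π₂ si₂
  ... | inj₂ two | _        = two-reducts⇒two-members π₁∈C |π₁| (subst (TwoReducts π₁) |π₁| two)
  ... | inj₁ _   | inj₂ two = two-reducts⇒two-members π₂∈C |π₂| (subst (TwoReducts π₂) |π₂| two)
  ... | inj₁ e₁  | inj₁ e₂  =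
    distinct-deletions⇒two-members π₁∈C π₂∈C |π₁| |π₂| p₁ p₂
      (exceptional-deletion k p₁ e₁′) (exceptional-deletion k p₂ e₂′)
      (exceptional-reducts-distinct k p₁ p₂ e₁′ e₂′ π₁≢π₂)
    where
    p₁ = proj₁ si₁
    p₂ = proj₁ si₂
    e₁′ = subst (Exceptional π₁) |π₁| e₁
    e₂′ = subst (Exceptional π₂) |π₂| e₂

proposition6p3 :
    (∀ (n : ℕ) (π : List ℕ) → length π ≡ n → SumIndecomposable π →
      (π ≡ decr n ⊎ π ≡ incr (n ∸ 1) ⊖ (0 ∷ []) ⊎ π ≡ (0 ∷ []) ⊖ incr (n ∸ 1))
      ⊎ (∃[ σ₁ ] ∃[ σ₂ ] (σ₁ ≢ σ₂ ×
            length σ₁ ≡ n ∸ 1 × SumIndecomposable σ₁ × σ₁ ≼ π ×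
            length σ₂ ≡ n ∸ 1 × SumIndecomposable σ₂ × σ₂ ≼ π)))
    ×
    (∀ (C : PermClass) (n : ℕ) → 4 ≤ n →
      (∃[ π₁ ] ∃[ π₂ ] (π₁ ≢ π₂ ×
            mem C π₁ × length π₁ ≡ n × SumIndecomposable π₁ ×
            mem C π₂ × length π₂ ≡ n × SumIndecomposable π₂)) →
      (∃[ σ₁ ] ∃[ σ₂ ] (σ₁ ≢ σ₂ ×
            mem C σ₁ × length σ₁ ≡ n ∸ 1 × SumIndecomposable σ₁ ×
            mem C σ₂ × length σ₂ ≡ n ∸ 1 × SumIndecomposable σ₂)))
proposition6p3 =
  (λ n π |π|≡n si → subst (λ m → Exceptional π m ⊎ TwoReducts π m) |π|≡n
                      (sumIndecomposable⇒exceptional-or-two-reducts π si)) ,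
  two-members⇒two-members-shorter
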